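{- Let $k,s,m$ be positive integers with $k\leq s\leq 2k-1$ and $m\geq 4^s+1$. Then $\mathrm{rc}_k(K_{s,m})\geq 5$.
   Context: Given an edge coloring $c:E(G)\to[\ell]$, a path is rainbow if no two of its edges receive the same color. $(G,c)$ is rainbow $k$-connected if every pair of distinct vertices is joined by $k$ pairwise internally disjoint rainbow paths. The rainbow $k$-connection number $\mathrm{rc}_k(G)$ is the minimum $\ell$ such that some coloring $c:E(G)\to[\ell]$ makes $(G,c)$ rainbow $k$-connected (taken to be $\infty$ if no such coloring exists). $K_{s,m}$ denotes the complete bipartite graph with parts of sizes $s$ and $m$. -}

module Defs where

open import Data.Nat using (ℕ; _<_)
open import Data.Fin using (Fin)
open import Data.Sum using (_⊎_; inj₁; inj₂)
open import Data.Product using (_×_; _,_; Σ-syntax)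
open import Data.List using (List; []; _∷_; map)
open import Data.List.Membership.Propositional using (_∈_; _∉_)
open import Data.List.Relation.Unary.Unique.Propositional using (Unique)
open import Relation.Binary.PropositionalEquality using (_≡_; _≢_)
open import Relation.Nullary using (¬_)

-- A (simple, undirected) graph: vertices, edges, adjacency, and the edge
-- underlying each adjacency (symmetric adjacencies map to the same edge).
record Graph : Set₁ where
  field
    V    : Set
    E    : Set
    _~_  : V → V → Set
    edge : ∀ {u v} → u ~ v → E

module _ (G : Graph) where
  open Graph G

  data Walk : V → V → Set where
    nil  : ∀ {u} → Walk u u
    cons : ∀ {u w v} → u ~ w → Walk w v → Walk u v

  verts : ∀ {u v} → Walk u v → List V
  verts {u} nil = u ∷ []
  verts {u} (cons _ p) = u ∷ verts p

  initVerts : ∀ {u v} → Walk u v → List V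
  initVerts nil = []
  initVerts {u} (cons _ p) = u ∷ initVerts p

  inner : ∀ {u v} → Walk u v → List V
  inner nil = []
  inner (cons _ p) = initVerts p

  edges : ∀ {u v} → Walk u v → List E
  edges nil = []
  edges (cons a p) = edge a ∷ edges p

  IsPath : ∀ {u v} → Walk u v → Set
  IsPath p = Unique (verts p)

  Rainbow : ∀ {ℓ u v} → (E → Fin ℓ) → Walk u v → Set
  Rainbow c p = Unique (map c (edges p))

  InternallyDisjoint : ∀ {u v} → Walk u v → Walk u v → Set
  InternallyDisjoint p q = ∀ x → x ∈ inner p → x ∉ inner q

  RainbowKConnected : ∀ {ℓ} → ℕ → (E → Fin ℓ) → Set
  RainbowKConnected k c =
    ∀ u v → u ≢ v →
    Σ[ P ∈ (Fin k → Walk u v) ]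
      ((∀ i → IsPath (P i)) × (∀ i → Rainbow c (P i)) ×
       (∀ i j → i ≢ j → (P i ≢ P j) × InternallyDisjoint (P i) (P j)))

  -- rc_k(G) ≥ n  (rc_k being the minimum ℓ admitting a rainbow k-connected
  -- colouring c : E → [ℓ], or ∞ if none): no ℓ < n admits such a colouring
  RcAtLeast : ℕ → ℕ → Set
  RcAtLeast k n = ∀ ℓ → ℓ < n → (c : E → Fin ℓ) → ¬ RainbowKConnected k c

data BipAdj (s m : ℕ) : Fin s ⊎ Fin m → Fin s ⊎ Fin m → Set where
  lr : (i : Fin s) (j : Fin m) → BipAdj s m (inj₁ i) (inj₂ j)
  rl : (i : Fin s) (j : Fin m) → BipAdj s m (inj₂ j) (inj₁ i)

bipEdge : ∀ {s m u v} → BipAdj s m u v → Fin s × Fin m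
bipEdge (lr i j) = i , j
bipEdge (rl i j) = i , j

K : ℕ → ℕ → Graph
K s m = record { V = Fin s ⊎ Fin m ; E = Fin s × Fin m ; _~_ = BipAdj s m ; edge = bipEdge }

module Submission where

open import Defs
open import Data.Nat using (ℕ; _≤_; _<_; _^_; _+_; _*_; _∸_; suc; s≤s)
open import Data.Nat.Properties using (≤-trans; ^-monoˡ-≤; +-comm; +-identityʳ; <⇒≱)
open import Data.Fin using (Fin; splitAt; join; funToFin; finToFun)
open import Data.Fin.Properties using (pigeonhole; injective⇒≤; finToFun-funToFin; join-splitAt; <⇒≢; _≟_)
open import Data.Sum using (_⊎_; inj₁; inj₂; [_,_]′; reduce)
open import Data.Sum.Properties using (inj₂-injective)
open import Data.Product using (_×_; _,_; proj₂; ∃₂)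
open import Data.List.Membership.Propositional using (_∈_)
open import Data.List.Relation.Unary.Any using (here; there)
open import Data.List.Relation.Unary.All using (_∷_)
open import Data.List.Relation.Unary.AllPairs using (_∷_)
open import Function using (_∘_)
open import Function.Definitions using (Injective)
open import Relation.Binary.PropositionalEquality using (_≡_; _≢_; refl; sym; cong; subst; module ≡-Reasoning)
open import Relation.Nullary using (yes; no)
open import Data.Empty using (⊥-elim)

-- With at most four colours, two vertices a, b of the big side see every
-- vertex of the small side in the same colour (pigeonhole on the ℓ ^ s colour
-- vectors). A rainbow a–b path cannot be a, i, b, so it passes through two
-- distinct small-side vertices; k internally disjoint such paths use 2k of
-- them, but s < 2k.

module _ (G : Graph) where
  open Graph G

  record TwoInner {A : Set} (ι : A → V) {u v : V} (p : Walk G u v) : Set where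
    field
      fst snd : A
      fst≢snd : fst ≢ snd
      fst∈    : ι fst ∈ inner G p
      snd∈    : ι snd ∈ inner G p

  module _ {n k : ℕ} {u v : V} (ι : Fin n → V) (P : Fin k → Walk G u v)
           (disjoint : ∀ i j → i ≢ j → InternallyDisjoint G (P i) (P j))
           (two : ∀ i → TwoInner ι (P i)) where
    open TwoInner

    pick : Fin k ⊎ Fin k → Fin n
    pick = [ fst ∘ two , snd ∘ two ]′

    pick∈ : ∀ t → ι (pick t) ∈ inner G (P (reduce t))
    pick∈ (inj₁ i) = fst∈ (two i)
    pick∈ (inj₂ i) = snd∈ (two i)

    sharedInner⇒samePath : ∀ {i j a b} → ι a ∈ inner G (P i) → ι b ∈ inner G (P j) →
                           a ≡ b → i ≡ j
    sharedInner⇒samePath {i} {j} a∈ b∈ refl with i ≟ j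
    ... | yes i≡j = i≡j
    ... | no  i≢j = ⊥-elim (disjoint i j i≢j _ a∈ b∈)

    pick-injective : Injective _≡_ _≡_ pick
    pick-injective {inj₁ i} {inj₁ j} e
      with refl ← sharedInner⇒samePath (pick∈ (inj₁ i)) (pick∈ (inj₁ j)) e = refl
    pick-injective {inj₂ i} {inj₂ j} e
      with refl ← sharedInner⇒samePath (pick∈ (inj₂ i)) (pick∈ (inj₂ j)) e = refl
    pick-injective {inj₁ i} {inj₂ j} e
      with refl ← sharedInner⇒samePath (pick∈ (inj₁ i)) (pick∈ (inj₂ j)) e =
        ⊥-elim (fst≢snd (two i) e)
    pick-injective {inj₂ i} {inj₁ j} e
      with refl ← sharedInner⇒samePath (pick∈ (inj₂ i)) (pick∈ (inj₁ j)) e =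
        ⊥-elim (fst≢snd (two i) (sym e))

    disjointWalks-twoInner⇒k+k≤n : k + k ≤ n
    disjointWalks-twoInner⇒k+k≤n =
      injective⇒≤ {f = pick ∘ splitAt k} (splitAt-injective ∘ pick-injective)
      where
      splitAt-injective : Injective _≡_ _≡_ (splitAt k {k})
      splitAt-injective {x} {y} e = begin
        x                         ≡⟨ sym (join-splitAt k k x) ⟩
        join k k (splitAt k x)    ≡⟨ cong (join k k) e ⟩
        join k k (splitAt k y)    ≡⟨ join-splitAt k k y ⟩
        y                         ∎
        where open ≡-Reasoning

module _ {s m ℓ : ℕ} (c : Fin s × Fin m → Fin ℓ) where

  ColourTwins : Fin m → Fin m → Set
  ColourTwins a b = ∀ i → c (i , a) ≡ c (i , b)

  ^<⇒colourTwins : ℓ ^ s < m → ∃₂ λ a b → a ≢ b × ColourTwins a b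
  ^<⇒colourTwins ℓ^s<m
    with a , b , a<b , same ← pigeonhole ℓ^s<m (λ j → funToFin (λ i → c (i , j))) =
      a , b , <⇒≢ a<b , twins
    where
    twins : ColourTwins a b
    twins i = begin
      c (i , a)                                   ≡⟨ sym (finToFun-funToFin _ i) ⟩
      finToFun (funToFin (λ i → c (i , a))) i     ≡⟨ cong (λ f → finToFun f i) same ⟩
      finToFun (funToFin (λ i → c (i , b))) i     ≡⟨ finToFun-funToFin _ i ⟩
      c (i , b)                                   ∎
      where open ≡-Reasoning

  twinRainbowPath⇒twoInner : ∀ {a b} → a ≢ b → ColourTwins a b →
    (p : Walk (K s m) (inj₂ a) (inj₂ b)) → IsPath (K s m) p → Rainbow (K s m) c p →
    TwoInner (K s m) inj₁ p
  twinRainbowPath⇒twoInner a≢b _ nil _ _ = ⊥-elim (a≢b refl)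
  twinRainbowPath⇒twoInner _ twins (cons (rl i _) (cons (lr .i _) nil)) _
    ((different ∷ _) ∷ _) = ⊥-elim (different (twins i))
  twinRainbowPath⇒twoInner _ _ (cons (rl i _) (cons (lr .i w) (cons (rl j .w) (cons _ _))))
    (_ ∷ (_ ∷ i≢j ∷ _) ∷ _) _ =
      record { fst = i ; snd = j ; fst≢snd = i≢j ∘ cong inj₁
             ; fst∈ = here refl ; snd∈ = there (there (here refl)) }

s≤2k∸1⇒s<k+k : ∀ {k s} → 1 ≤ k → s ≤ 2 * k ∸ 1 → s < k + k
s≤2k∸1⇒s<k+k {suc k} {s} _ s≤ = s≤s (subst (λ n → s ≤ k + n) (+-identityʳ (suc k)) s≤)

≤⇒^< : ∀ {ℓ n m} s → ℓ ≤ n → n ^ s + 1 ≤ m → ℓ ^ s < m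
≤⇒^< {n = n} {m} s ℓ≤n n^s+1≤m =
  ≤-trans (s≤s (^-monoˡ-≤ s ℓ≤n)) (subst (_≤ m) (+-comm (n ^ s) 1) n^s+1≤m)

mainTheorem5 : (k s m : ℕ) → 1 ≤ k → k ≤ s → s ≤ 2 * k ∸ 1 → 4 ^ s + 1 ≤ m →
    RcAtLeast (K s m) k 5
mainTheorem5 k s m 1≤k _ s≤2k∸1 4^s+1≤m ℓ (s≤s ℓ≤4) c connected
  with a , b , a≢b , twins ← ^<⇒colourTwins c (≤⇒^< s ℓ≤4 4^s+1≤m)
  with P , paths , rainbows , pairwise ← connected (inj₂ a) (inj₂ b) (a≢b ∘ inj₂-injective) =
    <⇒≱ (s≤2k∸1⇒s<k+k 1≤k s≤2k∸1)
        (disjointWalks-twoInner⇒k+k≤n (K s m) inj₁ P (λ i j i≢j → proj₂ (pairwise i j i≢j))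
           (λ i → twinRainbowPath⇒twoInner c a≢b twins (P i) (paths i) (rainbows i)))
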